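{- Let $n\ge 1$. The smallest eigenvalue of the adjacency matrix of a connected component of the graph $R_n$ is $-n/2$ if $n$ is even and $(1-n)/2$ if $n$ is odd.
   Context: The $n$-dimensional hypercube $Q_n$ has vertex set $\{0,1\}^n$, two vertices adjacent when they differ in exactly one coordinate. $R_n$ is the graph with vertex set $\{0,1\}^n$ in which two vertices are adjacent if and only if they are at distance exactly $2$ in $Q_n$ (i.e. differ in exactly two coordinates). -}

module Defs where

open import Level using (Level; _⊔_) renaming (suc to lsuc)
open import Data.Bool using (Bool; true; false; if_then_else_; _xor_; T)
open import Data.Nat as ℕ using (ℕ; zero; suc)
open import Data.Vec using (Vec; []; _∷_)
open import Data.List as List using (List; []; _∷_)
open import Data.Product using (Σ; ∃; _×_; _,_)
open import Relation.Nullary using (¬_)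
open import Relation.Binary using (Rel; IsTotalOrder)
open import Algebra.Bundles using (CommutativeRing)

Vertex : ℕ → Set
Vertex n = Vec Bool n

hamming : ∀ {n} → Vertex n → Vertex n → ℕ
hamming [] [] = 0
hamming (a ∷ u) (b ∷ w) = (if a xor b then 1 else 0) ℕ.+ hamming u w

R-adj : ∀ {n} → Vertex n → Vertex n → Bool
R-adj u w = hamming u w ℕ.≡ᵇ 2

-- enumeration of all 2^n vertices (each exactly once)
allVertices : ∀ n → List (Vertex n)
allVertices zero = [] ∷ []
allVertices (suc n) =
  List.map (false ∷_) (allVertices n) List.++ List.map (true ∷_) (allVertices n)

data Reach {n : ℕ} (v : Vertex n) : Vertex n → Set where
  here : Reach v v
  step : ∀ {u w} → Reach v u → T (R-adj u w) → Reach v w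

-- Ordered fields (the scalars; ℝ is one of them)

record OrderedField (c ℓ₁ ℓ₂ : Level) : Set (lsuc (c ⊔ ℓ₁ ⊔ ℓ₂)) where
  field
    commutativeRing : CommutativeRing c ℓ₁
  open CommutativeRing commutativeRing public
  field
    _≤_          : Rel Carrier ℓ₂
    isTotalOrder : IsTotalOrder _≈_ _≤_
    0≉1          : ¬ (0# ≈ 1#)
    inverse      : ∀ x → ¬ (x ≈ 0#) → ∃ λ y → x * y ≈ 1#
    +-mono-≤     : ∀ {x y} z → x ≤ y → (x + z) ≤ (y + z)
    *-nonneg     : ∀ {x y} → 0# ≤ x → 0# ≤ y → 0# ≤ (x * y)

module _ {c ℓ₁ ℓ₂} (F : OrderedField c ℓ₁ ℓ₂) where
  open OrderedField F

  fromℕ : ℕ → Carrier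
  fromℕ zero = 0#
  fromℕ (suc m) = 1# + fromℕ m

  sumF : ∀ {A : Set} → List A → (A → Carrier) → Carrier
  sumF xs f = List.foldr (λ a s → f a + s) 0# xs

  -- (A x)(w), A the adjacency matrix of R_n
  adjApply : ∀ {n} → (Vertex n → Carrier) → Vertex n → Carrier
  adjApply {n} x w = sumF (allVertices n) (λ u → if R-adj w u then x u else 0#)

  -- x (a vector on the vertices of the component C of v0, extended by 0
  -- outside C) is an eigenvector of the adjacency matrix of C for μ
  IsComponentEigenvector : ∀ {n} → Vertex n → Carrier → (Vertex n → Carrier) → Set (ℓ₁)
  IsComponentEigenvector v0 μ x =
    (∀ w → ¬ Reach v0 w → x w ≈ 0#) ×
    (∃ λ w → Reach v0 w × ¬ (x w ≈ 0#)) ×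
    (∀ w → Reach v0 w → adjApply x w ≈ (μ * x w))

  IsComponentEigenvalue : ∀ {n} → Vertex n → Carrier → Set (c ⊔ ℓ₁)
  IsComponentEigenvalue v0 μ = ∃ λ x → IsComponentEigenvector v0 μ x

  IsSmallestComponentEigenvalue : ∀ {n} → Vertex n → Carrier → Set (c ⊔ ℓ₁ ⊔ ℓ₂)
  IsSmallestComponentEigenvalue v0 lam =
    IsComponentEigenvalue v0 lam ×
    (∀ μ → IsComponentEigenvalue v0 μ → lam ≤ μ)

-- The components of R_n are the parity classes of {0,1}ⁿ, and a character
-- w ↦ (−1)^⟨s,w⟩ restricted to a parity class is an eigenvector of its component; for s
-- alternating 1,0,1,0,… the eigenvalue is −⌊n/2⌋.
-- For the lower bound there is no spectral theorem over an ordered field, so we show by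
-- induction on n, for every integer t, that an eigenvector x of A₂ + t A₁ on Q_n (A_d the
-- distance-d matrix) with eigenvalue μ and 2μ ≤ m := [n + t odd] − t² − n satisfies
-- (m − 2μ) x = 0. Splitting x along the first coordinate, x₀ + x₁ and x₀ − x₁ are
-- eigenvectors of A₂ + (t ± 1) A₁ on Q_{n−1} for μ ∓ t, with the same gap m − 2μ; the
-- base case n = 0 uses t² ≥ [t odd]. At t = 0 we get m = −2⌊n/2⌋, and an eigenvector of
-- a component, extended by zero, is an eigenvector of A₂.
module Submission where

open import Algebra.Bundles using (CommutativeRing)
open import Algebra.Solver.Ring.AlmostCommutativeRing using (fromCommutativeRing; _-Raw-AlmostCommutative⟶_)
open import Data.Bool.Base using (Bool; true; false; not; _xor_; _∧_; if_then_else_; T)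
open import Data.Bool.Properties as Bool
  using (not-involutive; not-injective; not-distribˡ-xor; not-distribʳ-xor; xor-identityʳ; xor-same; xor-inverseʳ; xor-∧-commutativeRing)
open import Data.Integer.Base as ℤ using (ℤ; +_; -[1+_]; +[1+_]; 0ℤ; 1ℤ; _⊖_; _◃_; sign; ∣_∣)
import Data.Integer.Properties as ℤ
open import Data.Integer.Tactic.RingSolver using (solve-∀)
open import Data.List.Base as List using (List; []; _∷_; _++_)
open import Data.Maybe.Base using (Maybe; just; nothing)
open import Data.Nat.Base as ℕ using (ℕ; zero; suc; ⌊_/2⌋)
import Data.Nat.Properties as ℕ
open import Data.Product.Base as Prod using (_,_; proj₁; proj₂)
open import Data.Sign.Base as Sign using (Sign)
open import Data.Sum.Base using (inj₁; inj₂)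
open import Data.Vec.Base using (Vec; []; _∷_)
open import Relation.Binary using (IsTotalOrder)
open import Relation.Binary.PropositionalEquality as ≡ using (_≡_; _≢_; module ≡-Reasoning)
open import Relation.Nullary using (¬_; yes; no; does; contradiction)

open import Defs

open CommutativeRing xor-∧-commutativeRing using () renaming (+-commutativeSemigroup to xor-commutativeSemigroup)
open import Algebra.Properties.CommutativeSemigroup xor-commutativeSemigroup using () renaming (interchange to xor-interchange)

bit : Bool → ℕ
bit b = if b then 1 else 0

isOdd : ℕ → Bool
isOdd zero    = false
isOdd (suc n) = not (isOdd n)

isOdd-bit : ∀ b → isOdd (bit b) ≡ b
isOdd-bit true  = ≡.refl
isOdd-bit false = ≡.refl

isOdd-+ : ∀ m n → isOdd (m ℕ.+ n) ≡ isOdd m xor isOdd n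
isOdd-+ zero    n = ≡.refl
isOdd-+ (suc m) n = ≡.trans (≡.cong not (isOdd-+ m n)) (not-distribˡ-xor (isOdd m) (isOdd n))

bit-isOdd+⌊n/2⌋+⌊n/2⌋≡n : ∀ n → bit (isOdd n) ℕ.+ (⌊ n /2⌋ ℕ.+ ⌊ n /2⌋) ≡ n
bit-isOdd+⌊n/2⌋+⌊n/2⌋≡n zero          = ≡.refl
bit-isOdd+⌊n/2⌋+⌊n/2⌋≡n (suc zero)    = ≡.refl
bit-isOdd+⌊n/2⌋+⌊n/2⌋≡n (suc (suc n)) rewrite not-involutive (isOdd n) = begin
  bit (isOdd n) ℕ.+ (suc h ℕ.+ suc h)   ≡⟨ ≡.cong (bit (isOdd n) ℕ.+_) (≡.cong suc (ℕ.+-suc h h)) ⟩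
  bit (isOdd n) ℕ.+ suc (suc (h ℕ.+ h)) ≡⟨ ℕ.+-suc (bit (isOdd n)) (suc (h ℕ.+ h)) ⟩
  suc (bit (isOdd n) ℕ.+ suc (h ℕ.+ h)) ≡⟨ ≡.cong suc (ℕ.+-suc (bit (isOdd n)) (h ℕ.+ h)) ⟩
  suc (suc (bit (isOdd n) ℕ.+ (h ℕ.+ h))) ≡⟨ ≡.cong (λ m → suc (suc m)) (bit-isOdd+⌊n/2⌋+⌊n/2⌋≡n n) ⟩
  suc (suc n) ∎
  where
  open ≡-Reasoning
  h = ⌊ n /2⌋

⌊1+n+n/2⌋≡n : ∀ n → ⌊ suc (n ℕ.+ n) /2⌋ ≡ n
⌊1+n+n/2⌋≡n zero    = ≡.refl
⌊1+n+n/2⌋≡n (suc n) = ≡.cong suc (≡.trans (≡.cong ⌊_/2⌋ (ℕ.+-suc n n)) (⌊1+n+n/2⌋≡n n))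

isOddℤ : ℤ → Bool
isOddℤ t = isOdd ℤ.∣ t ∣

isOddℤ-suc : ∀ t → isOddℤ (ℤ.suc t) ≡ not (isOddℤ t)
isOddℤ-suc (+ m)          = ≡.refl
isOddℤ-suc -[1+ zero ]    = ≡.refl
isOddℤ-suc -[1+ suc m ]   = ≡.sym (not-involutive (isOdd (suc m)))

isOddℤ-pred : ∀ t → isOddℤ (ℤ.pred t) ≡ not (isOddℤ t)
isOddℤ-pred (+ zero)    = ≡.refl
isOddℤ-pred +[1+ m ]    = ≡.sym (not-involutive (isOdd m))
isOddℤ-pred -[1+ m ]    = ≡.refl

-- The eigenvalues of A₂ + t A₁ on Q_n are ((d + t)² − t² − n)/2 with d ≡ n (mod 2), and
-- (d + t)² ≥ [n + t odd]; twiceLeast n t is twice the resulting lower bound.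
twiceLeast : ℕ → ℤ → ℤ
twiceLeast n t = + bit (isOdd n xor isOddℤ t) ℤ.- t ℤ.* t ℤ.- + n

twiceLeast-suc : ∀ n t → twiceLeast n (ℤ.suc t) ≡ twiceLeast (suc n) t ℤ.- (t ℤ.+ t)
twiceLeast-suc n t
  rewrite isOddℤ-suc t | ≡.sym (not-distribʳ-xor (isOdd n) (isOddℤ t)) | not-distribˡ-xor (isOdd n) (isOddℤ t)
  = shift (+ bit (not (isOdd n) xor isOddℤ t)) t (+ n)
  where
  shift : ∀ e t m → e ℤ.- (1ℤ ℤ.+ t) ℤ.* (1ℤ ℤ.+ t) ℤ.- m ≡ (e ℤ.- t ℤ.* t ℤ.- (1ℤ ℤ.+ m)) ℤ.- (t ℤ.+ t)
  shift = solve-∀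

twiceLeast-pred : ∀ n t → twiceLeast n (ℤ.pred t) ≡ twiceLeast (suc n) t ℤ.+ (t ℤ.+ t)
twiceLeast-pred n t
  rewrite isOddℤ-pred t | ≡.sym (not-distribʳ-xor (isOdd n) (isOddℤ t)) | not-distribˡ-xor (isOdd n) (isOddℤ t)
  = shift (+ bit (not (isOdd n) xor isOddℤ t)) t (+ n)
  where
  shift : ∀ e t m → e ℤ.- (ℤ.-1ℤ ℤ.+ t) ℤ.* (ℤ.-1ℤ ℤ.+ t) ℤ.- m ≡ (e ℤ.- t ℤ.* t ℤ.- (1ℤ ℤ.+ m)) ℤ.+ (t ℤ.+ t)
  shift = solve-∀

bit≤1 : ∀ b → + bit b ℤ.≤ 1ℤ
bit≤1 true  = ℤ.≤-refl
bit≤1 false = ℤ.+≤+ ℕ.z≤n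

bit-isOddℤ≤t*t : ∀ t → + bit (isOddℤ t) ℤ.≤ t ℤ.* t
bit-isOddℤ≤t*t (+ zero)  = ℤ.≤-refl
bit-isOddℤ≤t*t +[1+ m ]  = ℤ.≤-trans (bit≤1 _) (ℤ.+≤+ (ℕ.s≤s ℕ.z≤n))
bit-isOddℤ≤t*t -[1+ m ]  = ℤ.≤-trans (bit≤1 _) (ℤ.+≤+ (ℕ.s≤s ℕ.z≤n))

twiceLeast[0,t]≤0 : ∀ t → twiceLeast 0 t ℤ.≤ 0ℤ
twiceLeast[0,t]≤0 t =
  ≡.subst (ℤ._≤ 0ℤ) (≡.sym (ℤ.+-identityʳ _)) (ℤ.i≤j⇒i-j≤0 (bit-isOddℤ≤t*t t))

twiceLeast[n,0]≡-2⌊n/2⌋ : ∀ n → twiceLeast n 0ℤ ≡ ℤ.- + (⌊ n /2⌋ ℕ.+ ⌊ n /2⌋)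
twiceLeast[n,0]≡-2⌊n/2⌋ n rewrite xor-identityʳ (isOdd n) = begin
  + b ℤ.- 0ℤ ℤ.- + n                      ≡⟨ ≡.cong (λ m → + b ℤ.- 0ℤ ℤ.- + m) (≡.sym (bit-isOdd+⌊n/2⌋+⌊n/2⌋≡n n)) ⟩
  + b ℤ.- 0ℤ ℤ.- + (b ℕ.+ hh)             ≡⟨ cancel (+ b) (+ hh) ⟩
  ℤ.- + hh                                 ∎
  where
  open ≡-Reasoning
  b = bit (isOdd n)
  hh = ⌊ n /2⌋ ℕ.+ ⌊ n /2⌋
  cancel : ∀ x y → x ℤ.- 0ℤ ℤ.- (x ℤ.+ y) ≡ ℤ.- y
  cancel = solve-∀

-- Components of R_n

parity : ∀ {n} → Vertex n → Bool
parity []      = false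
parity (b ∷ w) = b xor parity w

isOdd-hamming : ∀ {n} (w u : Vertex n) → isOdd (hamming w u) ≡ parity w xor parity u
isOdd-hamming []      []      = ≡.refl
isOdd-hamming (a ∷ w) (b ∷ u) = begin
  isOdd (bit (a xor b) ℕ.+ hamming w u)          ≡⟨ isOdd-+ (bit (a xor b)) (hamming w u) ⟩
  isOdd (bit (a xor b)) xor isOdd (hamming w u)  ≡⟨ ≡.cong₂ _xor_ (isOdd-bit (a xor b)) (isOdd-hamming w u) ⟩
  (a xor b) xor (parity w xor parity u)          ≡⟨ xor-interchange a b (parity w) (parity u) ⟩
  (a xor parity w) xor (b xor parity u)          ∎
  where open ≡-Reasoning

xor≡false⇒≡ : ∀ a b → a xor b ≡ false → a ≡ b
xor≡false⇒≡ true  true  _ = ≡.refl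
xor≡false⇒≡ false false _ = ≡.refl

adjacent⇒parity≡ : ∀ {n} (w u : Vertex n) → T (R-adj w u) → parity w ≡ parity u
adjacent⇒parity≡ w u adj = xor≡false⇒≡ _ _ (≡.trans (≡.sym (isOdd-hamming w u)) (≡.cong isOdd hamming≡2))
  where
  hamming≡2 : hamming w u ≡ 2
  hamming≡2 = ℕ.≡ᵇ⇒≡ (hamming w u) 2 adj

Reach⇒parity≡ : ∀ {n} {v w : Vertex n} → Reach v w → parity v ≡ parity w
Reach⇒parity≡ here                  = ≡.refl
Reach⇒parity≡ (step {u} {w} r adj)  = ≡.trans (Reach⇒parity≡ r) (adjacent⇒parity≡ u w adj)

hamming-refl : ∀ {n} (v : Vertex n) → hamming v v ≡ 0
hamming-refl []      = ≡.refl
hamming-refl (a ∷ v) rewrite xor-same a = hamming-refl v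

Reach-∷ : ∀ {n} a {v w : Vertex n} → Reach v w → Reach (a ∷ v) (a ∷ w)
Reach-∷ a     here         = here
Reach-∷ false (step r adj) = step (Reach-∷ false r) adj
Reach-∷ true  (step r adj) = step (Reach-∷ true r) adj

Reach-trans : ∀ {n} {v u w : Vertex n} → Reach v u → Reach u w → Reach v w
Reach-trans r here         = r
Reach-trans r (step r′ adj) = step (Reach-trans r r′) adj

flip-two-adjacent : ∀ {n} a c (v : Vertex n) → T (R-adj (a ∷ c ∷ v) (not a ∷ not c ∷ v))
flip-two-adjacent a c v rewrite xor-inverseʳ a | xor-inverseʳ c | hamming-refl v = _

parity≡⇒Reach : ∀ {n} (v w : Vertex n) → parity v ≡ parity w → Reach v w
parity≡⇒Reach []                []          _ = here
parity≡⇒Reach (false ∷ v)       (false ∷ w) e = Reach-∷ false (parity≡⇒Reach v w e)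
parity≡⇒Reach (true ∷ v)        (true ∷ w)  e = Reach-∷ true (parity≡⇒Reach v w (not-injective e))
parity≡⇒Reach (false ∷ [])      (true ∷ []) ()
parity≡⇒Reach (true ∷ [])       (false ∷ []) ()
parity≡⇒Reach (false ∷ c ∷ v)   (true ∷ w)  e = Reach-trans (step here (flip-two-adjacent false c v))
  (Reach-∷ true (parity≡⇒Reach (not c ∷ v) w
    (≡.trans (≡.sym (not-distribˡ-xor c (parity v))) (≡.trans (≡.cong not e) (not-involutive (parity w))))))
parity≡⇒Reach (true ∷ c ∷ v)    (false ∷ w) e = Reach-trans (step here (flip-two-adjacent true c v))
  (Reach-∷ false (parity≡⇒Reach (not c ∷ v) w (≡.trans (≡.sym (not-distribˡ-xor c (parity v))) e)))

module _ {c ℓ₁ ℓ₂} (F : OrderedField c ℓ₁ ℓ₂) where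
  open OrderedField F hiding (zero)
  open import Algebra.Properties.Ring ring using (-1*x≈-x; -‿involutive; -0#≈0#; -‿+-comm)
  open import Algebra.Properties.Group +-group using (x∙y⁻¹≈ε⇒x≈y; x≈y⇒x∙y⁻¹≈ε)
  open import Algebra.Properties.Semiring.Mult.TCOptimised semiring using (_×_; ×-homo-+; ×1-homo-*; 1+×)
  open import Algebra.Properties.CommutativeSemigroup +-commutativeSemigroup using () renaming (interchange to +-interchange)
  open import Algebra.Properties.CommutativeSemigroup *-commutativeSemigroup using () renaming (interchange to *-interchange)
  open import Relation.Binary.Reasoning.Setoid setoid

  -- The ring solver needs integer coefficients: over coefficients in F it could not cancel x − x.
  fromℤ : ℤ → Carrier
  fromℤ (+ m)     = m × 1#
  fromℤ -[1+ m ]  = - (suc m × 1#)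

  private
    x≈x-0 : ∀ x → x ≈ x - 0#
    x≈x-0 x = sym (trans (+-congˡ -0#≈0#) (+-identityʳ x))

  fromℤ-⊖ : ∀ m n → fromℤ (m ⊖ n) ≈ m × 1# - n × 1#
  fromℤ-⊖ zero    zero    = x≈x-0 0#
  fromℤ-⊖ (suc m) zero    = x≈x-0 _
  fromℤ-⊖ zero    (suc n) = sym (+-identityˡ _)
  fromℤ-⊖ (suc m) (suc n) = begin
    fromℤ (suc m ⊖ suc n)             ≡⟨ ≡.cong fromℤ (ℤ.[1+m]⊖[1+n]≡m⊖n m n) ⟩
    fromℤ (m ⊖ n)                     ≈⟨ fromℤ-⊖ m n ⟩
    a - b                             ≈⟨ +-identityˡ (a - b) ⟨
    0# + (a - b)                      ≈⟨ +-congʳ (-‿inverseʳ 1#) ⟨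
    (1# - 1#) + (a - b)               ≈⟨ +-interchange 1# (- 1#) a (- b) ⟩
    (1# + a) + (- 1# - b)             ≈⟨ +-congˡ (-‿+-comm 1# b) ⟩
    (1# + a) - (1# + b)               ≈⟨ +-cong (1+× m 1#) (-‿cong (1+× n 1#)) ⟨
    suc m × 1# - suc n × 1#           ∎
    where
    a = m × 1#
    b = n × 1#

  fromℤ-neg : ∀ i → fromℤ (ℤ.- i) ≈ - fromℤ i
  fromℤ-neg (+ zero)   = sym -0#≈0#
  fromℤ-neg (+ suc m)  = refl
  fromℤ-neg -[1+ m ]   = sym (-‿involutive _)

  fromℤ-+ : ∀ i j → fromℤ (i ℤ.+ j) ≈ fromℤ i + fromℤ j
  fromℤ-+ (+ m)     (+ n)     = ×-homo-+ 1# m n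
  fromℤ-+ (+ m)     -[1+ n ]  = fromℤ-⊖ m (suc n)
  fromℤ-+ -[1+ m ]  (+ n)     = trans (fromℤ-⊖ n (suc m)) (+-comm _ _)
  fromℤ-+ -[1+ m ]  -[1+ n ]  = begin
    - (suc (suc (m ℕ.+ n)) × 1#)      ≡⟨ ≡.cong (λ k → - (suc k × 1#)) (ℕ.+-suc m n) ⟨
    - ((suc m ℕ.+ suc n) × 1#)        ≈⟨ -‿cong (×-homo-+ 1# (suc m) (suc n)) ⟩
    - (suc m × 1# + suc n × 1#)       ≈⟨ -‿+-comm _ _ ⟨
    fromℤ -[1+ m ] + fromℤ -[1+ n ]   ∎

  fromSign : Sign → Carrier
  fromSign Sign.+ = 1#
  fromSign Sign.- = - 1#

  fromSign-* : ∀ s t → fromSign (s Sign.* t) ≈ fromSign s * fromSign t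
  fromSign-* Sign.- Sign.- = sym (trans (-1*x≈-x (- 1#)) (-‿involutive 1#))
  fromSign-* Sign.- Sign.+ = sym (*-identityʳ _)
  fromSign-* Sign.+ t      = sym (*-identityˡ _)

  fromℤ-◃ : ∀ s n → fromℤ (s ◃ n) ≈ fromSign s * (n × 1#)
  fromℤ-◃ s      zero    = sym (zeroʳ _)
  fromℤ-◃ Sign.+ (suc n) = sym (*-identityˡ _)
  fromℤ-◃ Sign.- (suc n) = sym (-1*x≈-x _)

  fromℤ-* : ∀ i j → fromℤ (i ℤ.* j) ≈ fromℤ i * fromℤ j
  fromℤ-* i j = begin
    fromℤ (sign i Sign.* sign j ◃ ∣ i ∣ ℕ.* ∣ j ∣)
      ≈⟨ fromℤ-◃ _ (∣ i ∣ ℕ.* ∣ j ∣) ⟩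
    fromSign (sign i Sign.* sign j) * ((∣ i ∣ ℕ.* ∣ j ∣) × 1#)
      ≈⟨ *-cong (fromSign-* (sign i) (sign j)) (×1-homo-* ∣ i ∣ ∣ j ∣) ⟩
    (fromSign (sign i) * fromSign (sign j)) * (∣ i ∣ × 1# * ∣ j ∣ × 1#)
      ≈⟨ *-interchange _ _ _ _ ⟩
    (fromSign (sign i) * ∣ i ∣ × 1#) * (fromSign (sign j) * ∣ j ∣ × 1#)
      ≈⟨ *-cong (sign◃abs i) (sign◃abs j) ⟩
    fromℤ i * fromℤ j ∎
    where
    sign◃abs : ∀ i → fromSign (sign i) * ∣ i ∣ × 1# ≈ fromℤ i
    sign◃abs i = trans (sym (fromℤ-◃ (sign i) ∣ i ∣)) (reflexive (≡.cong fromℤ (ℤ.signᵢ◃∣i∣≡i i)))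

  fromℤ-morphism : ℤ.+-*-rawRing -Raw-AlmostCommutative⟶ fromCommutativeRing commutativeRing
  fromℤ-morphism = record
    { ⟦_⟧ = fromℤ ; +-homo = fromℤ-+ ; *-homo = fromℤ-* ; -‿homo = fromℤ-neg ; 0-homo = refl ; 1-homo = refl }

  fromℤ-≟ : ∀ i j → Maybe (fromℤ i ≈ fromℤ j)
  fromℤ-≟ i j with i ℤ.≟ j
  ... | yes ≡.refl = just refl
  ... | no _       = nothing

  open import Algebra.Solver.Ring ℤ.+-*-rawRing (fromCommutativeRing commutativeRing) fromℤ-morphism fromℤ-≟
    using (solve; _:=_; _:+_; _:*_; _:-_; :-_; con)

  module ≤ = IsTotalOrder isTotalOrder

  ≤-resp-≈ : ∀ {x x′ y y′} → x ≈ x′ → y ≈ y′ → x ≤ y → x′ ≤ y′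
  ≤-resp-≈ x≈x′ y≈y′ x≤y = ≤.≲-respˡ-≈ x≈x′ (≤.≲-respʳ-≈ y≈y′ x≤y)

  +-monoʳ-≤ : ∀ z {x y} → x ≤ y → (z + x) ≤ (z + y)
  +-monoʳ-≤ z x≤y = ≤-resp-≈ (+-comm _ z) (+-comm _ z) (+-mono-≤ z x≤y)

  x≤y⇒0≤y-x : ∀ {x y} → x ≤ y → 0# ≤ (y - x)
  x≤y⇒0≤y-x {x} x≤y = ≤.≲-respˡ-≈ (-‿inverseʳ x) (+-mono-≤ (- x) x≤y)

  0≤-x⇒x≤0 : ∀ {x} → 0# ≤ (- x) → x ≤ 0#
  0≤-x⇒x≤0 {x} 0≤-x = ≤-resp-≈ (+-identityʳ x) (-‿inverseʳ x) (+-monoʳ-≤ x 0≤-x)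

  0≤1 : 0# ≤ 1#
  0≤1 with ≤.total 0# 1#
  ... | inj₁ 0≤1 = 0≤1
  ... | inj₂ 1≤0 = ≤.≲-respʳ-≈ (solve 0 ((:- con 1ℤ) :* (:- con 1ℤ) := con 1ℤ) refl) (*-nonneg 0≤-1 0≤-1)
    where
    0≤-1 : 0# ≤ (- 1#)
    0≤-1 = ≤-resp-≈ (-‿inverseʳ 1#) (+-identityˡ (- 1#)) (+-mono-≤ (- 1#) 1≤0)

  1≰0 : ¬ 1# ≤ 0#
  1≰0 1≤0 = 0≉1 (≤.antisym 0≤1 1≤0)

  0≤x+y : ∀ {x y} → 0# ≤ x → 0# ≤ y → 0# ≤ (x + y)
  0≤x+y {x} {y} 0≤x 0≤y = ≤.trans 0≤y (≤.≲-respˡ-≈ (+-identityˡ y) (+-mono-≤ y 0≤x))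

  1≤1+x : ∀ {x} → 0# ≤ x → 1# ≤ (1# + x)
  1≤1+x 0≤x = ≤.≲-respˡ-≈ (+-identityʳ 1#) (+-monoʳ-≤ 1# 0≤x)

  0≤×1 : ∀ m → 0# ≤ (m × 1#)
  0≤×1 zero    = ≤.refl
  0≤×1 (suc m) = ≤.≲-respʳ-≈ (sym (1+× m 1#)) (0≤x+y 0≤1 (0≤×1 m))

  0≰-[1+m]×1 : ∀ m → ¬ 0# ≤ (- (suc m × 1#))
  0≰-[1+m]×1 m 0≤- = 1≰0 (≤.trans (≤.≲-respʳ-≈ (sym (1+× m 1#)) (1≤1+x (0≤×1 m))) (0≤-x⇒x≤0 0≤-))

  1+1≉0 : ¬ 1# + 1# ≈ 0#
  1+1≉0 2≈0 = 1≰0 (≤.≲-respʳ-≈ 2≈0 (1≤1+x 0≤1))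

  *-cancelˡ-≈0 : ∀ {a x} → ¬ a ≈ 0# → a * x ≈ 0# → x ≈ 0#
  *-cancelˡ-≈0 {a} {x} a≉0 ax≈0 with inverse a a≉0
  ... | b , ab≈1 = begin
    x             ≈⟨ *-identityˡ x ⟨
    1# * x        ≈⟨ *-congʳ ab≈1 ⟨
    (a * b) * x   ≈⟨ solve 3 (λ a b x → (a :* b) :* x := b :* (a :* x)) refl a b x ⟩
    b * (a * x)   ≈⟨ *-congˡ ax≈0 ⟩
    b * 0#        ≈⟨ zeroʳ b ⟩
    0#            ∎

  x+x≈y+y⇒x≈y : ∀ {x y} → x + x ≈ y + y → x ≈ y
  x+x≈y+y⇒x≈y {x} {y} 2x≈2y = x∙y⁻¹≈ε⇒x≈y x y (*-cancelˡ-≈0 1+1≉0 (begin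
    (1# + 1#) * (x - y)   ≈⟨ solve 2 (λ x y → (con 1ℤ :+ con 1ℤ) :* (x :- y) := (x :+ x) :- (y :+ y)) refl x y ⟩
    (x + x) - (y + y)     ≈⟨ x≈y⇒x∙y⁻¹≈ε 2x≈2y ⟩
    0#                    ∎))

  -- The distance matrices A_d of Q_n

  sumF-++ : ∀ {A : Set} (xs ys : List A) f → sumF F (xs ++ ys) f ≈ sumF F xs f + sumF F ys f
  sumF-++ []       ys f = sym (+-identityˡ _)
  sumF-++ (a ∷ xs) ys f = trans (+-congˡ (sumF-++ xs ys f)) (sym (+-assoc _ _ _))

  sumF-map : ∀ {A B : Set} (g : A → B) (xs : List A) f → sumF F (List.map g xs) f ≡ sumF F xs (λ a → f (g a))
  sumF-map g []       f = ≡.refl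
  sumF-map g (a ∷ xs) f = ≡.cong (λ s → f (g a) + s) (sumF-map g xs f)

  sumF-cong : ∀ {A : Set} (xs : List A) {f g} → (∀ a → f a ≈ g a) → sumF F xs f ≈ sumF F xs g
  sumF-cong []       f≈g = refl
  sumF-cong (a ∷ xs) f≈g = +-cong (f≈g a) (sumF-cong xs f≈g)

  sumF-+ : ∀ {A : Set} (xs : List A) f g → sumF F xs (λ a → f a + g a) ≈ sumF F xs f + sumF F xs g
  sumF-+ []       f g = sym (+-identityˡ 0#)
  sumF-+ (a ∷ xs) f g = trans (+-congˡ (sumF-+ xs f g)) (+-interchange (f a) (g a) _ _)

  sumF-* : ∀ {A : Set} (xs : List A) c f → sumF F xs (λ a → c * f a) ≈ c * sumF F xs f
  sumF-* []       c f = sym (zeroʳ c)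
  sumF-* (a ∷ xs) c f = trans (+-congˡ (sumF-* xs c f)) (sym (distribˡ c _ _))

  sumF-0 : ∀ {A : Set} (xs : List A) → sumF F xs (λ _ → 0#) ≈ 0#
  sumF-0 []       = refl
  sumF-0 (a ∷ xs) = trans (+-identityˡ _) (sumF-0 xs)

  sumF-allVertices-suc : ∀ {n} f → sumF F (allVertices (suc n)) f ≈
                         sumF F (allVertices n) (λ u → f (false ∷ u)) + sumF F (allVertices n) (λ u → f (true ∷ u))
  sumF-allVertices-suc {n} f = trans (sumF-++ (List.map (false ∷_) (allVertices n)) _ f)
    (reflexive (≡.cong₂ _+_ (sumF-map (false ∷_) (allVertices n) f) (sumF-map (true ∷_) (allVertices n) f)))

  onSphere : ℕ → ∀ {n} → (Vertex n → Carrier) → Vertex n → Vertex n → Carrier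
  onSphere d x w u = if hamming w u ℕ.≡ᵇ d then x u else 0#

  A[_] : ℕ → ∀ {n} → (Vertex n → Carrier) → Vertex n → Carrier
  A[ d ] {n} x w = sumF F (allVertices n) (onSphere d x w)

  A-cong-sphere : ∀ d {n} {x y : Vertex n → Carrier} w →
                  (∀ u → T (hamming w u ℕ.≡ᵇ d) → x u ≈ y u) → A[ d ] x w ≈ A[ d ] y w
  A-cong-sphere d {n} w x≈y = sumF-cong (allVertices n) (λ u → if-cong (hamming w u ℕ.≡ᵇ d) (x≈y u))
    where
    if-cong : ∀ b {p q} → (T b → p ≈ q) → (if b then p else 0#) ≈ (if b then q else 0#)
    if-cong true  p≈q = p≈q _
    if-cong false p≈q = refl

  A-0 : ∀ d {n} (w : Vertex n) → A[ d ] (λ _ → 0#) w ≈ 0#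
  A-0 d {n} w = trans (sumF-cong (allVertices n) (λ u → if-0 (hamming w u ℕ.≡ᵇ d))) (sumF-0 (allVertices n))
    where
    if-0 : ∀ b → (if b then 0# else 0#) ≈ 0#
    if-0 true  = refl
    if-0 false = refl

  A-+ : ∀ d {n} (x y : Vertex n → Carrier) w → A[ d ] (λ u → x u + y u) w ≈ A[ d ] x w + A[ d ] y w
  A-+ d {n} x y w = trans (sumF-cong (allVertices n) (λ u → if-+ (hamming w u ℕ.≡ᵇ d))) (sumF-+ (allVertices n) _ _)
    where
    if-+ : ∀ b {p q} → (if b then p + q else 0#) ≈ (if b then p else 0#) + (if b then q else 0#)
    if-+ true  = refl
    if-+ false = sym (+-identityˡ 0#)

  A-* : ∀ d {n} a (x : Vertex n → Carrier) w → A[ d ] (λ u → a * x u) w ≈ a * A[ d ] x w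
  A-* d {n} a x w = trans (sumF-cong (allVertices n) (λ u → if-* (hamming w u ℕ.≡ᵇ d))) (sumF-* (allVertices n) a _)
    where
    if-* : ∀ b {p} → (if b then a * p else 0#) ≈ a * (if b then p else 0#)
    if-* true  = refl
    if-* false = sym (zeroʳ a)

  A-- : ∀ d {n} (x y : Vertex n → Carrier) w → A[ d ] (λ u → x u - y u) w ≈ A[ d ] x w - A[ d ] y w
  A-- d x y w = begin
    A[ d ] (λ u → x u - y u) w          ≈⟨ A-+ d x (λ u → - y u) w ⟩
    A[ d ] x w + A[ d ] (λ u → - y u) w ≈⟨ +-congˡ (A-cong-sphere d w (λ u _ → -1*x≈-x (y u))) ⟨
    A[ d ] x w + A[ d ] (λ u → - 1# * y u) w ≈⟨ +-congˡ (trans (A-* d (- 1#) y w) (-1*x≈-x _)) ⟩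
    A[ d ] x w - A[ d ] y w              ∎

  A[_-1] : ℕ → ∀ {n} → (Vertex n → Carrier) → Vertex n → Carrier
  A[ zero  -1] x w = 0#
  A[ suc d -1] x w = A[ d ] x w

  A-∷ : ∀ d {n} b (x : Vertex (suc n) → Carrier) (w : Vertex n) →
        A[ d ] x (b ∷ w) ≈ A[ d ] (λ u → x (b ∷ u)) w + A[ d -1] (λ u → x (not b ∷ u)) w
  A-∷ d {n} b x w = trans (sumF-allVertices-suc (onSphere d x (b ∷ w))) (heads d b)
    where
    heads : ∀ d b → sumF F (allVertices n) (λ u → onSphere d x (b ∷ w) (false ∷ u))
                      + sumF F (allVertices n) (λ u → onSphere d x (b ∷ w) (true ∷ u))
                    ≈ A[ d ] (λ u → x (b ∷ u)) w + A[ d -1] (λ u → x (not b ∷ u)) w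
    heads zero    false = +-congˡ (sumF-0 (allVertices n))
    heads (suc d) false = refl
    heads zero    true  = trans (+-congʳ (sumF-0 (allVertices n))) (+-comm _ _)
    heads (suc d) true  = +-comm _ _

  A[0] : ∀ {n} (x : Vertex n → Carrier) w → A[ 0 ] x w ≈ x w
  A[0] x []      = +-identityʳ _
  A[0] x (b ∷ w) = trans (A-∷ 0 b x w) (trans (+-identityʳ _) (A[0] (λ u → x (b ∷ u)) w))

  -- The least eigenvalue of A₂ + t A₁

  EigenEquation : ∀ {n} → ℤ → Carrier → (Vertex n → Carrier) → Set ℓ₁
  EigenEquation t μ x = ∀ w → A[ 2 ] x w + fromℤ t * A[ 1 ] x w ≈ μ * x w

  module _ {n} {t μ} {x : Vertex (suc n) → Carrier} (eig : EigenEquation t μ x) where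
    private
      a = fromℤ t
      x₀ x₁ : Vertex n → Carrier
      x₀ u = x (false ∷ u)
      x₁ u = x (true ∷ u)

      eig-∷ : ∀ b w → let xᵇ = λ u → x (b ∷ u); xⁿ = λ u → x (not b ∷ u) in
              (A[ 2 ] xᵇ w + A[ 1 ] xⁿ w) + a * (A[ 1 ] xᵇ w + xⁿ w) ≈ μ * xᵇ w
      eig-∷ b w = trans (sym (+-cong (A-∷ 2 b x w) (*-congˡ (trans (A-∷ 1 b x w) (+-congˡ (A[0] _ w)))))) (eig (b ∷ w))

    eigen-sum : EigenEquation (ℤ.suc t) (μ - a) (λ u → x₀ u + x₁ u)
    eigen-sum w = begin
      A[ 2 ] (λ u → x₀ u + x₁ u) w + fromℤ (ℤ.suc t) * A[ 1 ] (λ u → x₀ u + x₁ u) w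
        ≈⟨ +-cong (A-+ 2 x₀ x₁ w) (*-cong (fromℤ-+ 1ℤ t) (A-+ 1 x₀ x₁ w)) ⟩
      (A₂₀ + A₂₁) + (1# + a) * (A₁₀ + A₁₁)
        ≈⟨ solve 7 (λ A₂₀ A₂₁ A₁₀ A₁₁ y₀ y₁ a →
                (A₂₀ :+ A₂₁) :+ (con 1ℤ :+ a) :* (A₁₀ :+ A₁₁)
             := (((A₂₀ :+ A₁₁) :+ a :* (A₁₀ :+ y₁)) :+ ((A₂₁ :+ A₁₀) :+ a :* (A₁₁ :+ y₀))) :- a :* (y₀ :+ y₁))
             refl A₂₀ A₂₁ A₁₀ A₁₁ (x₀ w) (x₁ w) a ⟩
      (((A₂₀ + A₁₁) + a * (A₁₀ + x₁ w)) + ((A₂₁ + A₁₀) + a * (A₁₁ + x₀ w))) - a * (x₀ w + x₁ w)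
        ≈⟨ +-congʳ (+-cong (eig-∷ false w) (eig-∷ true w)) ⟩
      (μ * x₀ w + μ * x₁ w) - a * (x₀ w + x₁ w)
        ≈⟨ solve 4 (λ μ a y₀ y₁ → (μ :* y₀ :+ μ :* y₁) :- a :* (y₀ :+ y₁) := (μ :- a) :* (y₀ :+ y₁))
                   refl μ a (x₀ w) (x₁ w) ⟩
      (μ - a) * (x₀ w + x₁ w) ∎
      where
      A₂₀ = A[ 2 ] x₀ w
      A₂₁ = A[ 2 ] x₁ w
      A₁₀ = A[ 1 ] x₀ w
      A₁₁ = A[ 1 ] x₁ w

    eigen-diff : EigenEquation (ℤ.pred t) (μ + a) (λ u → x (false ∷ u) - x (true ∷ u))
    eigen-diff w = begin
      A[ 2 ] (λ u → x₀ u - x₁ u) w + fromℤ (ℤ.pred t) * A[ 1 ] (λ u → x₀ u - x₁ u) w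
        ≈⟨ +-cong (A-- 2 x₀ x₁ w) (*-cong (trans (fromℤ-+ ℤ.-1ℤ t) (+-comm _ _)) (A-- 1 x₀ x₁ w)) ⟩
      (A₂₀ - A₂₁) + (a - 1#) * (A₁₀ - A₁₁)
        ≈⟨ solve 7 (λ A₂₀ A₂₁ A₁₀ A₁₁ y₀ y₁ a →
                (A₂₀ :- A₂₁) :+ (a :- con 1ℤ) :* (A₁₀ :- A₁₁)
             := (((A₂₀ :+ A₁₁) :+ a :* (A₁₀ :+ y₁)) :- ((A₂₁ :+ A₁₀) :+ a :* (A₁₁ :+ y₀))) :+ a :* (y₀ :- y₁))
             refl A₂₀ A₂₁ A₁₀ A₁₁ (x₀ w) (x₁ w) a ⟩
      (((A₂₀ + A₁₁) + a * (A₁₀ + x₁ w)) - ((A₂₁ + A₁₀) + a * (A₁₁ + x₀ w))) + a * (x₀ w - x₁ w)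
        ≈⟨ +-congʳ (+-cong (eig-∷ false w) (-‿cong (eig-∷ true w))) ⟩
      (μ * x₀ w - μ * x₁ w) + a * (x₀ w - x₁ w)
        ≈⟨ solve 4 (λ μ a y₀ y₁ → (μ :* y₀ :- μ :* y₁) :+ a :* (y₀ :- y₁) := (μ :+ a) :* (y₀ :- y₁))
                   refl μ a (x₀ w) (x₁ w) ⟩
      (μ + a) * (x₀ w - x₁ w) ∎
      where
      A₂₀ = A[ 2 ] x₀ w
      A₂₁ = A[ 2 ] x₁ w
      A₁₀ = A[ 1 ] x₀ w
      A₁₁ = A[ 1 ] x₁ w

  gap : ℕ → ℤ → Carrier → Carrier
  gap n t μ = fromℤ (twiceLeast n t) - (μ + μ)

  gap-suc : ∀ n t μ → gap n (ℤ.suc t) (μ - fromℤ t) ≈ gap (suc n) t μ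
  gap-suc n t μ = begin
    fromℤ (twiceLeast n (ℤ.suc t)) - ((μ - a) + (μ - a))
      ≡⟨ ≡.cong (λ l → fromℤ l - ((μ - a) + (μ - a))) (twiceLeast-suc n t) ⟩
    fromℤ (L ℤ.- (t ℤ.+ t)) - ((μ - a) + (μ - a))
      ≈⟨ +-congʳ (trans (fromℤ-+ L _) (+-congˡ (trans (fromℤ-neg (t ℤ.+ t)) (-‿cong (fromℤ-+ t t))))) ⟩
    (fromℤ L - (a + a)) - ((μ - a) + (μ - a))
      ≈⟨ solve 3 (λ l μ a → (l :- (a :+ a)) :- ((μ :- a) :+ (μ :- a)) := l :- (μ :+ μ)) refl (fromℤ L) μ a ⟩
    fromℤ L - (μ + μ) ∎
    where
    a = fromℤ t
    L = twiceLeast (suc n) t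

  gap-pred : ∀ n t μ → gap n (ℤ.pred t) (μ + fromℤ t) ≈ gap (suc n) t μ
  gap-pred n t μ = begin
    fromℤ (twiceLeast n (ℤ.pred t)) - ((μ + a) + (μ + a))
      ≡⟨ ≡.cong (λ l → fromℤ l - ((μ + a) + (μ + a))) (twiceLeast-pred n t) ⟩
    fromℤ (L ℤ.+ (t ℤ.+ t)) - ((μ + a) + (μ + a))
      ≈⟨ +-congʳ (trans (fromℤ-+ L _) (+-congˡ (fromℤ-+ t t))) ⟩
    (fromℤ L + (a + a)) - ((μ + a) + (μ + a))
      ≈⟨ solve 3 (λ l μ a → (l :+ (a :+ a)) :- ((μ :+ a) :+ (μ :+ a)) := l :- (μ :+ μ)) refl (fromℤ L) μ a ⟩
    fromℤ L - (μ + μ) ∎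
    where
    a = fromℤ t
    L = twiceLeast (suc n) t

  gap*x≈0-base : ∀ l {μ y} → l ℤ.≤ 0ℤ → 0# ≤ (fromℤ l - (μ + μ)) → μ * y ≈ 0# → (fromℤ l - (μ + μ)) * y ≈ 0#
  gap*x≈0-base (+ zero) {μ} {y} _ _ μy≈0 = begin
    (0# - (μ + μ)) * y   ≈⟨ solve 2 (λ μ y → (con 0ℤ :- (μ :+ μ)) :* y := :- (μ :* y :+ μ :* y)) refl μ y ⟩
    - (μ * y + μ * y)    ≈⟨ -‿cong (+-cong μy≈0 μy≈0) ⟩
    - (0# + 0#)          ≈⟨ solve 0 (:- (con 0ℤ :+ con 0ℤ) := con 0ℤ) refl ⟩
    0#                   ∎
  gap*x≈0-base (+ suc m) (ℤ.+≤+ ())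
  gap*x≈0-base -[1+ m ] {μ} {y} _ 0≤gap μy≈0 = trans (*-congˡ (*-cancelˡ-≈0 μ≉0 μy≈0)) (zeroʳ _)
    where
    μ≉0 : ¬ μ ≈ 0#
    μ≉0 μ≈0 = 0≰-[1+m]×1 m (≤.≲-respʳ-≈ gap≈-[1+m] 0≤gap)
      where
      gap≈-[1+m] : - (suc m × 1#) - (μ + μ) ≈ - (suc m × 1#)
      gap≈-[1+m] = begin
        - (suc m × 1#) - (μ + μ)     ≈⟨ +-congˡ (-‿cong (+-cong μ≈0 μ≈0)) ⟩
        - (suc m × 1#) - (0# + 0#)   ≈⟨ solve 1 (λ X → X :- (con 0ℤ :+ con 0ℤ) := X) refl (- (suc m × 1#)) ⟩
        - (suc m × 1#)               ∎

  sum-diff≈0 : ∀ g p q → g * (p + q) ≈ 0# → g * (p - q) ≈ 0# → g * p ≈ 0# Prod.× g * q ≈ 0#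
  sum-diff≈0 g p q sum≈0 diff≈0 = x+x≈y+y⇒x≈y 2gp≈0 , x+x≈y+y⇒x≈y 2gq≈0
    where
    2gp≈0 : g * p + g * p ≈ 0# + 0#
    2gp≈0 = begin
      g * p + g * p                 ≈⟨ solve 3 (λ g p q → g :* p :+ g :* p := g :* (p :+ q) :+ g :* (p :- q)) refl g p q ⟩
      g * (p + q) + g * (p - q)     ≈⟨ +-cong sum≈0 diff≈0 ⟩
      0# + 0#                       ∎
    2gq≈0 : g * q + g * q ≈ 0# + 0#
    2gq≈0 = begin
      g * q + g * q                 ≈⟨ solve 3 (λ g p q → g :* q :+ g :* q := g :* (p :+ q) :- g :* (p :- q)) refl g p q ⟩
      g * (p + q) - g * (p - q)     ≈⟨ +-cong sum≈0 (trans (-‿cong diff≈0) -0#≈0#) ⟩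
      0# + 0#                       ∎

  gap*x≈0 : ∀ n t μ (x : Vertex n → Carrier) → EigenEquation t μ x → 0# ≤ gap n t μ → ∀ w → gap n t μ * x w ≈ 0#
  gap*x≈0 zero t μ x eig 0≤gap [] = gap*x≈0-base (twiceLeast 0 t) (twiceLeast[0,t]≤0 t) 0≤gap μx≈0
    where
    μx≈0 : μ * x [] ≈ 0#
    μx≈0 = trans (sym (eig [])) (solve 1 (λ a → (con 0ℤ :+ con 0ℤ) :+ a :* (con 0ℤ :+ con 0ℤ) := con 0ℤ) refl (fromℤ t))
  gap*x≈0 (suc n) t μ x eig 0≤gap (b ∷ w) = select b
    where
    sum≈0 : gap (suc n) t μ * (x (false ∷ w) + x (true ∷ w)) ≈ 0#
    sum≈0 = trans (*-congʳ (sym (gap-suc n t μ)))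
      (gap*x≈0 n (ℤ.suc t) (μ - fromℤ t) _ (eigen-sum {t = t} eig) (≤.≲-respʳ-≈ (sym (gap-suc n t μ)) 0≤gap) w)
    diff≈0 : gap (suc n) t μ * (x (false ∷ w) - x (true ∷ w)) ≈ 0#
    diff≈0 = trans (*-congʳ (sym (gap-pred n t μ)))
      (gap*x≈0 n (ℤ.pred t) (μ + fromℤ t) _ (eigen-diff {t = t} eig) (≤.≲-respʳ-≈ (sym (gap-pred n t μ)) 0≤gap) w)
    select : ∀ b → gap (suc n) t μ * x (b ∷ w) ≈ 0#
    select false = proj₁ (sum-diff≈0 _ _ _ sum≈0 diff≈0)
    select true  = proj₂ (sum-diff≈0 _ _ _ sum≈0 diff≈0)

  -- Characters

  σ : Bool → Carrier
  σ false = 1#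
  σ true  = - 1#

  σ-∧-not : ∀ c b → σ (c ∧ not b) ≈ σ c * σ (c ∧ b)
  σ-∧-not false b     = sym (*-identityˡ 1#)
  σ-∧-not true  false = sym (-1*x≈-x 1#)
  σ-∧-not true  true  = sym (trans (-1*x≈-x (- 1#)) (-‿involutive 1#))

  σ*σ≈1 : ∀ b → σ b * σ b ≈ 1#
  σ*σ≈1 false = *-identityˡ 1#
  σ*σ≈1 true  = trans (-1*x≈-x (- 1#)) (-‿involutive 1#)

  χ : ∀ {n} → Vec Bool n → Vertex n → Carrier
  χ []      []      = 1#
  χ (c ∷ s) (b ∷ w) = σ (c ∧ b) * χ s w

  χ*χ≈1 : ∀ {n} (s : Vec Bool n) w → χ s w * χ s w ≈ 1#
  χ*χ≈1 []      []      = *-identityˡ 1#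
  χ*χ≈1 (c ∷ s) (b ∷ w) = begin
    (σ (c ∧ b) * χ s w) * (σ (c ∧ b) * χ s w)   ≈⟨ *-interchange _ _ _ _ ⟩
    (σ (c ∧ b) * σ (c ∧ b)) * (χ s w * χ s w)   ≈⟨ *-cong (σ*σ≈1 (c ∧ b)) (χ*χ≈1 s w) ⟩
    1# * 1#                                     ≈⟨ *-identityˡ 1# ⟩
    1#                                          ∎

  χ≉0 : ∀ {n} (s : Vec Bool n) w → ¬ χ s w ≈ 0#
  χ≉0 s w χ≈0 = 0≉1 (trans (sym (zeroˡ 0#)) (trans (*-cong (sym χ≈0) (sym χ≈0)) (χ*χ≈1 s w)))

  θ₁ θ₂ : ∀ {n} → Vec Bool n → Carrier
  θ₁ []      = 0#
  θ₁ (c ∷ s) = σ c + θ₁ s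
  θ₂ []      = 0#
  θ₂ (c ∷ s) = θ₂ s + σ c * θ₁ s

  A₁-χ : ∀ {n} (s : Vec Bool n) w → A[ 1 ] (χ s) w ≈ θ₁ s * χ s w
  A₁-χ []      []      = solve 0 (con 0ℤ :+ con 0ℤ := con 0ℤ :* con 1ℤ) refl
  A₁-χ (c ∷ s) (b ∷ w) = begin
    A[ 1 ] (χ (c ∷ s)) (b ∷ w)
      ≈⟨ A-∷ 1 b (χ (c ∷ s)) w ⟩
    A[ 1 ] (λ u → σ (c ∧ b) * χ s u) w + A[ 0 ] (λ u → σ (c ∧ not b) * χ s u) w
      ≈⟨ +-cong (A-* 1 _ (χ s) w) (A-* 0 _ (χ s) w) ⟩
    σ (c ∧ b) * A[ 1 ] (χ s) w + σ (c ∧ not b) * A[ 0 ] (χ s) w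
      ≈⟨ +-cong (*-congˡ (A₁-χ s w)) (*-cong (σ-∧-not c b) (A[0] (χ s) w)) ⟩
    σ (c ∧ b) * (θ₁ s * χ s w) + (σ c * σ (c ∧ b)) * χ s w
      ≈⟨ solve 4 (λ σcb σc θ X → σcb :* (θ :* X) :+ (σc :* σcb) :* X := (σc :+ θ) :* (σcb :* X))
                 refl (σ (c ∧ b)) (σ c) (θ₁ s) (χ s w) ⟩
    (σ c + θ₁ s) * (σ (c ∧ b) * χ s w) ∎

  A₂-χ : ∀ {n} (s : Vec Bool n) w → A[ 2 ] (χ s) w ≈ θ₂ s * χ s w
  A₂-χ []      []      = solve 0 (con 0ℤ :+ con 0ℤ := con 0ℤ :* con 1ℤ) refl
  A₂-χ (c ∷ s) (b ∷ w) = begin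
    A[ 2 ] (χ (c ∷ s)) (b ∷ w)
      ≈⟨ A-∷ 2 b (χ (c ∷ s)) w ⟩
    A[ 2 ] (λ u → σ (c ∧ b) * χ s u) w + A[ 1 ] (λ u → σ (c ∧ not b) * χ s u) w
      ≈⟨ +-cong (A-* 2 _ (χ s) w) (A-* 1 _ (χ s) w) ⟩
    σ (c ∧ b) * A[ 2 ] (χ s) w + σ (c ∧ not b) * A[ 1 ] (χ s) w
      ≈⟨ +-cong (*-congˡ (A₂-χ s w)) (*-cong (σ-∧-not c b) (A₁-χ s w)) ⟩
    σ (c ∧ b) * (θ₂ s * χ s w) + (σ c * σ (c ∧ b)) * (θ₁ s * χ s w)
      ≈⟨ solve 5 (λ σcb σc θ₁ θ₂ X → σcb :* (θ₂ :* X) :+ (σc :* σcb) :* (θ₁ :* X) := (θ₂ :+ σc :* θ₁) :* (σcb :* X))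
                 refl (σ (c ∧ b)) (σ c) (θ₁ s) (θ₂ s) (χ s w) ⟩
    (θ₂ s + σ c * θ₁ s) * (σ (c ∧ b) * χ s w) ∎

  alternating : ∀ n → Vec Bool n
  alternating zero          = []
  alternating (suc zero)    = false ∷ []
  alternating (suc (suc n)) = true ∷ false ∷ alternating n

  θ₂-alternating : ∀ n → θ₂ (alternating n) ≈ - fromℕ F ⌊ n /2⌋
  θ₂-alternating zero          = sym -0#≈0#
  θ₂-alternating (suc zero)    = trans (solve 0 (con 0ℤ :+ con 1ℤ :* con 0ℤ := con 0ℤ) refl) (sym -0#≈0#)
  θ₂-alternating (suc (suc n)) = begin
    (θ₂ s + 1# * θ₁ s) + - 1# * (1# + θ₁ s)
      ≈⟨ solve 2 (λ θ₁ θ₂ → (θ₂ :+ con 1ℤ :* θ₁) :+ (:- con 1ℤ) :* (con 1ℤ :+ θ₁) := θ₂ :- con 1ℤ) refl (θ₁ s) (θ₂ s) ⟩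
    θ₂ s - 1#
      ≈⟨ +-congʳ (θ₂-alternating n) ⟩
    - fromℕ F ⌊ n /2⌋ - 1#
      ≈⟨ trans (+-comm _ _) (-‿+-comm 1# _) ⟩
    - (1# + fromℕ F ⌊ n /2⌋) ∎
    where s = alternating n

  -- Eigenvalues of the components

  restrict : ∀ {n} → Bool → (Vertex n → Carrier) → Vertex n → Carrier
  restrict p x w = if does (parity w Bool.≟ p) then x w else 0#

  restrict-∈ : ∀ {n} {p} (x : Vertex n → Carrier) {w} → parity w ≡ p → restrict p x w ≈ x w
  restrict-∈ {p = p} x {w} w∈p with parity w Bool.≟ p
  ... | yes _   = refl
  ... | no  w∉p = contradiction w∈p w∉p

  restrict-∉ : ∀ {n} {p} (x : Vertex n → Carrier) {w} → parity w ≢ p → restrict p x w ≈ 0#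
  restrict-∉ {p = p} x {w} w∉p with parity w Bool.≟ p
  ... | yes w∈p = contradiction w∈p w∉p
  ... | no  _   = refl

  A₂-restrict : ∀ {n} p (x : Vertex n → Carrier) w → A[ 2 ] (restrict p x) w ≈ restrict p (A[ 2 ] x) w
  A₂-restrict p x w with parity w Bool.≟ p
  ... | yes w∈p = A-cong-sphere 2 w (λ u adj → restrict-∈ x (≡.trans (≡.sym (adjacent⇒parity≡ w u adj)) w∈p))
  ... | no  w∉p = trans (A-cong-sphere 2 w (λ u adj → restrict-∉ x (λ u∈p → w∉p (≡.trans (adjacent⇒parity≡ w u adj) u∈p))))
                        (A-0 2 w)

  restrict-scale : ∀ {n} p (x y : Vertex n → Carrier) a w → y w ≈ a * x w → restrict p y w ≈ a * restrict p x w
  restrict-scale p x y a w y≈ax with parity w Bool.≟ p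
  ... | yes _ = y≈ax
  ... | no  _ = sym (zeroʳ a)

  restrict-χ-isComponentEigenvector : ∀ {n} (v0 : Vertex n) s →
                                      IsComponentEigenvector F v0 (θ₂ s) (restrict (parity v0) (χ s))
  restrict-χ-isComponentEigenvector v0 s = outside , (v0 , here , nonzero) , eigen
    where
    outside : ∀ w → ¬ Reach v0 w → restrict (parity v0) (χ s) w ≈ 0#
    outside w v0↛w = restrict-∉ (χ s) (λ w∈p → v0↛w (parity≡⇒Reach v0 w (≡.sym w∈p)))
    nonzero : ¬ restrict (parity v0) (χ s) v0 ≈ 0#
    nonzero χ≈0 = χ≉0 s v0 (trans (sym (restrict-∈ (χ s) ≡.refl)) χ≈0)
    eigen : ∀ w → Reach v0 w → A[ 2 ] (restrict (parity v0) (χ s)) w ≈ θ₂ s * restrict (parity v0) (χ s) w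
    eigen w _ = trans (A₂-restrict (parity v0) (χ s) w) (restrict-scale (parity v0) (χ s) (A[ 2 ] (χ s)) (θ₂ s) w (A₂-χ s w))

  A₂-eigenvector : ∀ {n} {v0 : Vertex n} {μ y} → IsComponentEigenvector F v0 μ y → ∀ w → A[ 2 ] y w ≈ μ * y w
  A₂-eigenvector {v0 = v0} {μ} {y} (outside , _ , inside) w with parity v0 Bool.≟ parity w
  ... | yes v0~w = inside w (parity≡⇒Reach v0 w v0~w)
  ... | no  v0≁w = begin
    A[ 2 ] y w          ≈⟨ A-cong-sphere 2 w (λ u adj → outside u (v0↛ u adj)) ⟩
    A[ 2 ] (λ _ → 0#) w ≈⟨ A-0 2 w ⟩
    0#                  ≈⟨ zeroʳ μ ⟨
    μ * 0#              ≈⟨ *-congˡ (outside w (λ v0→w → v0≁w (Reach⇒parity≡ v0→w))) ⟨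
    μ * y w             ∎
    where
    v0↛ : ∀ u → T (R-adj w u) → ¬ Reach v0 u
    v0↛ u adj v0→u = v0≁w (≡.trans (Reach⇒parity≡ v0→u) (≡.sym (adjacent⇒parity≡ w u adj)))

  fromℕ≈×1 : ∀ m → fromℕ F m ≈ m × 1#
  fromℕ≈×1 zero    = refl
  fromℕ≈×1 (suc m) = trans (+-congˡ (fromℕ≈×1 m)) (sym (1+× m 1#))

  A₂-eigenvalue-lower-bound : ∀ {n} {μ} (y : Vertex n → Carrier) w → (∀ w → A[ 2 ] y w ≈ μ * y w) →
                              ¬ y w ≈ 0# → (- fromℕ F ⌊ n /2⌋) ≤ μ
  A₂-eigenvalue-lower-bound {n} {μ} y w eig y≉0 with ≤.total (- fromℕ F ⌊ n /2⌋) μ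
  ... | inj₁ -K≤μ = -K≤μ
  ... | inj₂ μ≤-K = ≤.reflexive (sym μ≈-K)
    where
    K = fromℕ F ⌊ n /2⌋
    L = fromℤ (twiceLeast n 0ℤ)
    L≈-2K : L ≈ - (K + K)
    L≈-2K = begin
      L                                      ≡⟨ ≡.cong fromℤ (twiceLeast[n,0]≡-2⌊n/2⌋ n) ⟩
      fromℤ (ℤ.- + (⌊ n /2⌋ ℕ.+ ⌊ n /2⌋))   ≈⟨ fromℤ-neg (+ (⌊ n /2⌋ ℕ.+ ⌊ n /2⌋)) ⟩
      - ((⌊ n /2⌋ ℕ.+ ⌊ n /2⌋) × 1#)         ≈⟨ -‿cong (×-homo-+ 1# ⌊ n /2⌋ ⌊ n /2⌋) ⟩
      - (⌊ n /2⌋ × 1# + ⌊ n /2⌋ × 1#)        ≈⟨ -‿cong (+-cong (fromℕ≈×1 ⌊ n /2⌋) (fromℕ≈×1 ⌊ n /2⌋)) ⟨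
      - (K + K)                              ∎
    eig₀ : EigenEquation 0ℤ μ y
    eig₀ w = trans (+-congˡ (zeroˡ _)) (trans (+-identityʳ _) (eig w))
    0≤gap : 0# ≤ gap n 0ℤ μ
    0≤gap = x≤y⇒0≤y-x (≤-resp-≈ refl (trans (-‿+-comm K K) (sym L≈-2K))
                        (≤.trans (+-mono-≤ μ μ≤-K) (+-monoʳ-≤ (- K) μ≤-K)))
    gap≈0 : gap n 0ℤ μ ≈ 0#
    gap≈0 = *-cancelˡ-≈0 y≉0 (trans (*-comm _ _) (gap*x≈0 n 0ℤ μ y eig₀ 0≤gap w))
    μ≈-K : μ ≈ - K
    μ≈-K = x+x≈y+y⇒x≈y (begin
      μ + μ        ≈⟨ x∙y⁻¹≈ε⇒x≈y L (μ + μ) gap≈0 ⟨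
      L            ≈⟨ L≈-2K ⟩
      - (K + K)    ≈⟨ -‿+-comm K K ⟨
      - K + - K    ∎)

  smallestComponentEigenvalue : ∀ {n} (v0 : Vertex n) → IsSmallestComponentEigenvalue F v0 (- fromℕ F ⌊ n /2⌋)
  smallestComponentEigenvalue {n} v0 = isEigenvalue , isSmallest
    where
    isEigenvalue : IsComponentEigenvalue F v0 (- fromℕ F ⌊ n /2⌋)
    isEigenvalue with restrict-χ-isComponentEigenvector v0 (alternating n)
    ... | outside , nonzero , eigen = restrict (parity v0) (χ (alternating n)) , outside , nonzero ,
                                      λ w v0→w → trans (eigen w v0→w) (*-congʳ (θ₂-alternating n))
    isSmallest : ∀ μ → IsComponentEigenvalue F v0 μ → (- fromℕ F ⌊ n /2⌋) ≤ μ
    isSmallest μ (y , isEig@(_ , (w , _ , y≉0) , _)) = A₂-eigenvalue-lower-bound y w (A₂-eigenvector isEig) y≉0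

open import Data.Nat.Base using (_*_; _≤_)
open import Data.Product.Base using (_×_)

lemma18 : ∀ {c ℓ₁ ℓ₂} (F : OrderedField c ℓ₁ ℓ₂) (n : ℕ) → 1 ≤ n →
    (v0 : Vertex n) (k : ℕ) →
    (n ≡ 2 * k → IsSmallestComponentEigenvalue F v0 (OrderedField.-_ F (fromℕ F k))) ×
    (n ≡ suc (2 * k) → IsSmallestComponentEigenvalue F v0 (OrderedField.-_ F (fromℕ F k)))
lemma18 F n _ v0 k =
  (λ n≡2k   → smallest (≡.trans (≡.cong ⌊_/2⌋ n≡2k) ⌊2k/2⌋≡k)) ,
  (λ n≡2k+1 → smallest (≡.trans (≡.cong ⌊_/2⌋ n≡2k+1) ⌊2k+1/2⌋≡k))
  where
  smallest : ⌊ n /2⌋ ≡ k → IsSmallestComponentEigenvalue F v0 (OrderedField.-_ F (fromℕ F k))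
  smallest h≡k = ≡.subst (λ h → IsSmallestComponentEigenvalue F v0 (OrderedField.-_ F (fromℕ F h)))
                         h≡k (smallestComponentEigenvalue F v0)
  2k≡k+k : 2 * k ≡ k ℕ.+ k
  2k≡k+k = ≡.cong (k ℕ.+_) (ℕ.+-identityʳ k)
  ⌊2k/2⌋≡k : ⌊ 2 * k /2⌋ ≡ k
  ⌊2k/2⌋≡k = ≡.trans (≡.cong ⌊_/2⌋ 2k≡k+k) (≡.sym (ℕ.n≡⌊n+n/2⌋ k))
  ⌊2k+1/2⌋≡k : ⌊ suc (2 * k) /2⌋ ≡ k
  ⌊2k+1/2⌋≡k = ≡.trans (≡.cong (λ m → ⌊ suc m /2⌋) 2k≡k+k) (⌊1+n+n/2⌋≡n k)
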